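{- Let $\mathcal L$ be a finite, bounded, atomic and graded lattice, let $\mathcal P$ be a geometric lattice, and let $f':A(\mathcal L)\to A(\mathcal P)$ be a bijection. If $f'$ can be extended to a rank-preserving order embedding $f:\mathcal L\to\mathcal P$, then $f(I)\in I(\mathcal P)$ for every $I\in I(\mathcal L)$.
   Context: A lattice is bounded if it has least element $\hat 0$ and greatest element $\hat 1$; graded if bounded with a rank function $\mathrm{rank}$ satisfying $\mathrm{rank}(\hat0)=0$, order-preserving, and increasing by exactly $1$ along covering relations. An atom is an element covering $\hat0$; $A(\mathcal L)$ is the set of atoms; atomic means every element is a join of atoms. For a linear order $\omega$ on $A(\mathcal L)$, a nonempty set $D\subseteq A(\mathcal L)$ is bounded below if some atom $a$ is strictly smaller than every $d\in D$ in $\omega$ and $a\le\bigvee D$ in $\mathcal L$; a set of atoms is NBB with respect to $\omega$ if it contains no bounded below subset. $I(\mathcal L)$ is the family of all sets of atoms that are NBB with respect to at least one linear order on $A(\mathcal L)$; $I(\mathcal P)$ is defined in the same way for the geometric lattice $\mathcal P$ (lattice of flats of a simple matroid). A rank-preserving order embedding is a map $f$ with $x\le y\iff f(x)\le f(y)$ and $\mathrm{rank}(f(x))=\mathrm{rank}(x)$; $f(I)=\{f(a):a\in I\}$. -}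

module Defs where

open import Level using (Level; _⊔_)
open import Data.Nat using (ℕ; zero; suc; _+_; _≤_)
open import Data.Fin using (Fin)
open import Data.List using (List; []; _∷_; foldr; map)
open import Data.List.Relation.Unary.All using (All)
open import Data.List.Relation.Unary.Any using (Any)
open import Data.Product using (Σ; ∃; _×_; _,_)
open import Data.Sum using (_⊎_)
open import Relation.Nullary using (¬_)
open import Relation.Binary.PropositionalEquality using (_≡_)
open import Relation.Binary.Lattice using (BoundedLattice)

module LatticeNotions {c ℓ₁ ℓ₂ : Level} (L : BoundedLattice c ℓ₁ ℓ₂) where
  open BoundedLattice L renaming (_≤_ to _≼_)

  _≺_ : Carrier → Carrier → Set (ℓ₁ ⊔ ℓ₂)
  x ≺ y = (x ≼ y) × ¬ (x ≈ y)

  _⋖_ : Carrier → Carrier → Set (c ⊔ ℓ₁ ⊔ ℓ₂)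
  x ⋖ y = (x ≺ y) × (∀ z → ¬ ((x ≺ z) × (z ≺ y)))

  IsFinite : Set (c ⊔ ℓ₁)
  IsFinite = Σ ℕ λ n → Σ (Fin n → Carrier) λ e → ∀ x → ∃ λ i → e i ≈ x

  record IsRank (rank : Carrier → ℕ) : Set (c ⊔ ℓ₁ ⊔ ℓ₂) where
    field
      rank-⊥    : rank ⊥ ≡ 0
      rank-mono : ∀ {x y} → x ≼ y → rank x ≤ rank y
      rank-⋖    : ∀ {x y} → x ⋖ y → rank y ≡ suc (rank x)

  IsGraded : Set (c ⊔ ℓ₁ ⊔ ℓ₂)
  IsGraded = Σ (Carrier → ℕ) IsRank

  IsAtom : Carrier → Set (c ⊔ ℓ₁ ⊔ ℓ₂)
  IsAtom a = ⊥ ⋖ a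

  ⋁ : List Carrier → Carrier
  ⋁ = foldr _∨_ ⊥

  -- finite sets of atoms are represented by lists of atoms
  IsAtomSet : List Carrier → Set (c ⊔ ℓ₁ ⊔ ℓ₂)
  IsAtomSet = All IsAtom

  IsAtomic : Set (c ⊔ ℓ₁ ⊔ ℓ₂)
  IsAtomic = ∀ x → Σ (List Carrier) λ D → IsAtomSet D × (⋁ D ≈ x)

  IsSemimodularRank : (Carrier → ℕ) → Set c
  IsSemimodularRank rank = ∀ x y → rank (x ∨ y) + rank (x ∧ y) ≤ rank x + rank y

  IsGeometric : Set (c ⊔ ℓ₁ ⊔ ℓ₂)
  IsGeometric = IsFinite × IsAtomic ×
                Σ (Carrier → ℕ) λ rank → IsRank rank × IsSemimodularRank rank

  record LinearOrderOnAtoms : Set (c ⊔ Level.suc ℓ₁ ⊔ Level.suc ℓ₂) where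
    field
      _<ω_     : Carrier → Carrier → Set (ℓ₁ ⊔ ℓ₂)
      resp     : ∀ {a a' b b'} → a ≈ a' → b ≈ b' → a <ω b → a' <ω b'
      irrefl   : ∀ {a} → IsAtom a → ¬ (a <ω a)
      trans    : ∀ {a b d} → IsAtom a → IsAtom b → IsAtom d →
                 a <ω b → b <ω d → a <ω d
      trichot  : ∀ {a b} → IsAtom a → IsAtom b →
                 (a <ω b) ⊎ (a ≈ b) ⊎ (b <ω a)

  _⊆ˢ_ : List Carrier → List Carrier → Set (c ⊔ ℓ₁)
  D ⊆ˢ I = All (λ d → Any (λ i → d ≈ i) I) D

  module _ (ω : LinearOrderOnAtoms) where
    open LinearOrderOnAtoms ω

    BoundedBelow : List Carrier → Set (c ⊔ ℓ₁ ⊔ ℓ₂)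
    BoundedBelow D = ¬ (D ≡ []) ×
      Σ Carrier λ a → IsAtom a × All (λ d → a <ω d) D × (a ≼ ⋁ D)

    IsNBB : List Carrier → Set (c ⊔ ℓ₁ ⊔ ℓ₂)
    IsNBB I = ∀ D → D ⊆ˢ I → ¬ BoundedBelow D

  InI : List Carrier → Set (c ⊔ Level.suc ℓ₁ ⊔ Level.suc ℓ₂)
  InI I = IsAtomSet I × Σ LinearOrderOnAtoms λ ω → IsNBB ω I

{-# OPTIONS --safe #-}
-- Since f is a bijection on atoms, the linear order ω on A(L) transports along f to a linear
-- order on A(P). If D ⊆ f(I) were bounded below by an atom p = f(a), write D = f(D') with
-- D' ⊆ I: then a is ω-below every element of D', and f(a) ≤ ⋁ D ≤ f(⋁ D') gives a ≤ ⋁ D'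
-- because f reflects the order, so D' would be bounded below in I.
module Submission where

open import Defs
open import Level using (Level; Lift; lift; _⊔_)
open import Data.Nat using (ℕ)
open import Data.Fin using (Fin)
open import Data.List using (List; []; _∷_; map; concatMap; length; lookup; allFin)
open import Data.List.Membership.Propositional.Properties using (∈-allFin)
open import Data.List.Relation.Unary.All using (All; []; _∷_)
import Data.List.Relation.Unary.All as All
import Data.List.Relation.Unary.All.Properties as All
open import Data.List.Relation.Unary.Any using (Any; here; index)
import Data.List.Relation.Unary.Any.Properties as Any
open import Data.List.Relation.Binary.Pointwise using (Pointwise; []; _∷_)
import Data.List.Relation.Binary.Pointwise as Pointwise
open import Data.List.Membership.Propositional using (lose)
import Data.List.Membership.Setoid as SetoidMembership
open import Data.Product using (Σ; ∃; ∃₂; _×_; _,_; proj₁; proj₂)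
open import Data.Sum using (_⊎_; inj₁; inj₂)
open import Data.Empty using (⊥-elim)
open import Relation.Nullary using (¬_; Dec; yes; no)
open import Relation.Nullary.Decidable using (True; toWitness; fromWitness; decidable-stable)
open import Relation.Binary.PropositionalEquality using (_≡_; refl)
open import Relation.Binary.Lattice using (BoundedLattice)

Pointwise-≢[] : ∀ {a b r} {A : Set a} {B : Set b} {R : A → B → Set r} {xs ys} →
                Pointwise R xs ys → ¬ (xs ≡ []) → ¬ (ys ≡ [])
Pointwise-≢[] []      []≢[] _  = []≢[] refl
Pointwise-≢[] (_ ∷ _) _     ()

module AtomProperties {c ℓ₁ ℓ₂ : Level} (L : BoundedLattice c ℓ₁ ℓ₂) where
  open BoundedLattice L
  open LatticeNotions L

  IsAtom-resp-≈ : ∀ {a b} → a ≈ b → IsAtom a → IsAtom b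
  IsAtom-resp-≈ a≈b ((_ , ⊥≉a) , a-covers) =
    (minimum _ , λ ⊥≈b → ⊥≉a (Eq.trans ⊥≈b (Eq.sym a≈b))) ,
    λ { z (⊥≺z , z≤b , z≉b) →
          a-covers z (⊥≺z , ≤-respʳ-≈ (Eq.sym a≈b) z≤b , λ z≈a → z≉b (Eq.trans z≈a a≈b)) }

  atom≤atom⇒¬¬≈ : ∀ {a d} → IsAtom a → IsAtom d → d ≤ a → ¬ ¬ (d ≈ a)
  atom≤atom⇒¬¬≈ (_ , a-covers) (⊥≺d , _) d≤a d≉a = a-covers _ (⊥≺d , d≤a , d≉a)

  IsAtomSet-⊆ˢ : ∀ {D I} → D ⊆ˢ I → IsAtomSet I → IsAtomSet D
  IsAtomSet-⊆ˢ D⊆I I-atoms = All.map (All.lookupₛ setoid IsAtom-resp-≈ I-atoms) D⊆I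

module LinearOrderOnAtomsProperties {c ℓ₁ ℓ₂ : Level} (L : BoundedLattice c ℓ₁ ℓ₂)
    (ω : LatticeNotions.LinearOrderOnAtoms L) where
  open BoundedLattice L using (_≈_; module Eq)
  open LatticeNotions L
  open LinearOrderOnAtoms ω

  <ω⇒≉ : ∀ {a b} → IsAtom a → a <ω b → ¬ (a ≈ b)
  <ω⇒≉ ha a<b a≈b = irrefl ha (resp Eq.refl (Eq.sym a≈b) a<b)

  _≈?_ : ∀ {a b} → IsAtom a → IsAtom b → Dec (a ≈ b)
  ha ≈? hb with trichot ha hb
  ... | inj₁ a<b        = no (<ω⇒≉ ha a<b)
  ... | inj₂ (inj₁ a≈b) = yes a≈b
  ... | inj₂ (inj₂ b<a) = no (λ a≈b → <ω⇒≉ hb b<a (Eq.sym a≈b))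

  _<ω?_ : ∀ {a b} → IsAtom a → IsAtom b → Dec (a <ω b)
  ha <ω? hb with trichot ha hb
  ... | inj₁ a<b        = yes a<b
  ... | inj₂ (inj₁ a≈b) = no (λ a<b → <ω⇒≉ ha a<b a≈b)
  ... | inj₂ (inj₂ b<a) = no (λ a<b → irrefl ha (trans ha hb ha a<b b<a))

module AtomEnumeration {c ℓ₁ ℓ₂ : Level} (L : BoundedLattice c ℓ₁ ℓ₂) where
  open BoundedLattice L
  open LatticeNotions L
  open AtomProperties L

  atomList : IsFinite → IsAtomic → List (∃ IsAtom)
  atomList (n , e , _) atomic = concatMap (λ i → All.toList (proj₁ (proj₂ (atomic (e i))))) (allFin n)

  module _ (_≈?_ : ∀ {a b} → IsAtom a → IsAtom b → Dec (a ≈ b)) where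

    ⋁-atoms≈atom⇒head≈ : ∀ {a D} → IsAtom a → (D-atoms : IsAtomSet D) → ⋁ D ≈ a →
                          Any (λ x → proj₁ x ≈ a) (All.toList D-atoms)
    ⋁-atoms≈atom⇒head≈ ((_ , ⊥≉a) , _) [] ⊥≈a = ⊥-elim (⊥≉a ⊥≈a)
    ⋁-atoms≈atom⇒head≈ {D = d ∷ ds} ha (hd ∷ _) ⋁D≈a =
      here (decidable-stable (hd ≈? ha) (atom≤atom⇒¬¬≈ ha hd (≤-respʳ-≈ ⋁D≈a (x≤x∨y d (⋁ ds)))))

    atomList-complete : (finite : IsFinite) (atomic : IsAtomic) →
                        ∀ {a} → IsAtom a → Any (λ x → proj₁ x ≈ a) (atomList finite atomic)
    atomList-complete (n , e , e-onto) atomic {a} ha =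
      let i , eᵢ≈a = e-onto a
          D , D-atoms , ⋁D≈eᵢ = atomic (e i)
      in Any.concat⁺ (Any.map⁺ (lose (∈-allFin i)
           (⋁-atoms≈atom⇒head≈ ha D-atoms (Eq.trans ⋁D≈eᵢ eᵢ≈a))))

module OrderEmbedding {c₁ ℓ₁ ℓ₂ c₂ ℓ₃ ℓ₄ : Level}
    (L : BoundedLattice c₁ ℓ₁ ℓ₂) (P : BoundedLattice c₂ ℓ₃ ℓ₄)
    (f : BoundedLattice.Carrier L → BoundedLattice.Carrier P)
    (f-mono : ∀ {x y} → BoundedLattice._≤_ L x y → BoundedLattice._≤_ P (f x) (f y))
    (f-reflect : ∀ {x y} → BoundedLattice._≤_ P (f x) (f y) → BoundedLattice._≤_ L x y)
    (f-onto-atoms : ∀ {p} → LatticeNotions.IsAtom P p →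
                    ∃ λ a → LatticeNotions.IsAtom L a × BoundedLattice._≈_ P (f a) p)
    where
  private
    module L = BoundedLattice L
    module P = BoundedLattice P
    module LN = LatticeNotions L
    module PN = LatticeNotions P

  f-cong : ∀ {x y} → x L.≈ y → f x P.≈ f y
  f-cong x≈y = P.antisym (f-mono (L.reflexive x≈y)) (f-mono (L.reflexive (L.Eq.sym x≈y)))

  f-injective : ∀ {x y} → f x P.≈ f y → x L.≈ y
  f-injective fx≈fy = L.antisym (f-reflect (P.reflexive fx≈fy)) (f-reflect (P.reflexive (P.Eq.sym fx≈fy)))

  module TransportOrder
      (atoms : List (∃ LN.IsAtom))
      (atoms-complete : ∀ {a} → LN.IsAtom a → Any (λ x → proj₁ x L.≈ a) atoms)
      (ω : LN.LinearOrderOnAtoms) where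
    open LN.LinearOrderOnAtoms ω
    open LinearOrderOnAtomsProperties L ω using (_<ω?_)

    private
      atom : Fin (length atoms) → L.Carrier
      atom i = proj₁ (lookup atoms i)

      isAtom : ∀ i → LN.IsAtom (atom i)
      isAtom i = proj₂ (lookup atoms i)

    -- An order on P must live in Set (ℓ₃ ⊔ ℓ₄), so it cannot quantify over the atoms of L;
    -- it quantifies over their finite enumeration instead, with the comparison decided to a Bool.
    _<ᶠ_ : P.Carrier → P.Carrier → Set (ℓ₃ ⊔ ℓ₄)
    p <ᶠ q = Lift ℓ₄ (∃₂ λ i j → f (atom i) P.≈ p × f (atom j) P.≈ q × True (isAtom i <ω? isAtom j))

    <ᶠ⇒<ω : ∀ {a c p q} → LN.IsAtom a → LN.IsAtom c → f a P.≈ p → f c P.≈ q → p <ᶠ q → a <ω c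
    <ᶠ⇒<ω _ _ fa≈p fc≈q (lift (i , j , fi≈p , fj≈q , i<j)) =
      resp (f-injective (P.Eq.trans fi≈p (P.Eq.sym fa≈p)))
           (f-injective (P.Eq.trans fj≈q (P.Eq.sym fc≈q)))
           (toWitness i<j)

    <ω⇒<ᶠ : ∀ {a c p q} → LN.IsAtom a → LN.IsAtom c → f a P.≈ p → f c P.≈ q → a <ω c → p <ᶠ q
    <ω⇒<ᶠ ha hc fa≈p fc≈q a<c =
      let a∈atoms = atoms-complete ha
          c∈atoms = atoms-complete hc
          i≈a = Any.lookup-index a∈atoms
          j≈c = Any.lookup-index c∈atoms
      in lift (index a∈atoms , index c∈atoms ,
               P.Eq.trans (f-cong i≈a) fa≈p , P.Eq.trans (f-cong j≈c) fc≈q ,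
               fromWitness (resp (L.Eq.sym i≈a) (L.Eq.sym j≈c) a<c))

    <ᶠ-resp : ∀ {p p' q q'} → p P.≈ p' → q P.≈ q' → p <ᶠ q → p' <ᶠ q'
    <ᶠ-resp p≈p' q≈q' (lift (i , j , fi≈p , fj≈q , i<j)) =
      lift (i , j , P.Eq.trans fi≈p p≈p' , P.Eq.trans fj≈q q≈q' , i<j)

    <ᶠ-irrefl : ∀ {p} → PN.IsAtom p → ¬ (p <ᶠ p)
    <ᶠ-irrefl hp p<p = let a , ha , fa≈p = f-onto-atoms hp in irrefl ha (<ᶠ⇒<ω ha ha fa≈p fa≈p p<p)

    <ᶠ-trans : ∀ {p q r} → PN.IsAtom p → PN.IsAtom q → PN.IsAtom r → p <ᶠ q → q <ᶠ r → p <ᶠ r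
    <ᶠ-trans hp hq hr p<q q<r =
      let a , ha , fa≈p = f-onto-atoms hp
          b , hb , fb≈q = f-onto-atoms hq
          c , hc , fc≈r = f-onto-atoms hr
      in <ω⇒<ᶠ ha hc fa≈p fc≈r
           (trans ha hb hc (<ᶠ⇒<ω ha hb fa≈p fb≈q p<q) (<ᶠ⇒<ω hb hc fb≈q fc≈r q<r))

    <ᶠ-trichot : ∀ {p q} → PN.IsAtom p → PN.IsAtom q → (p <ᶠ q) ⊎ (p P.≈ q) ⊎ (q <ᶠ p)
    <ᶠ-trichot hp hq with f-onto-atoms hp | f-onto-atoms hq
    ... | a , ha , fa≈p | b , hb , fb≈q with trichot ha hb
    ... | inj₁ a<b        = inj₁ (<ω⇒<ᶠ ha hb fa≈p fb≈q a<b)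
    ... | inj₂ (inj₁ a≈b) = inj₂ (inj₁ (P.Eq.trans (P.Eq.sym fa≈p) (P.Eq.trans (f-cong a≈b) fb≈q)))
    ... | inj₂ (inj₂ b<a) = inj₂ (inj₂ (<ω⇒<ᶠ hb ha fb≈q fa≈p b<a))

    transported : PN.LinearOrderOnAtoms
    transported = record
      { _<ω_    = _<ᶠ_
      ; resp    = <ᶠ-resp
      ; irrefl  = <ᶠ-irrefl
      ; trans   = <ᶠ-trans
      ; trichot = <ᶠ-trichot
      }

    transported-reflects : ∀ {a c} → LN.IsAtom a → LN.IsAtom c → f a <ᶠ f c → a <ω c
    transported-reflects ha hc = <ᶠ⇒<ω ha hc P.Eq.refl P.Eq.refl

  ⊆ˢ-map⁻ : ∀ {D I} → D PN.⊆ˢ map f I →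
            ∃ λ D' → D' LN.⊆ˢ I × Pointwise (λ d x → d P.≈ f x) D D'
  ⊆ˢ-map⁻ [] = [] , [] , []
  ⊆ˢ-map⁻ (d∈fI ∷ D⊆fI) =
    let x , x∈I , d≈fx = SetoidMembership.find L.setoid (Any.map⁻ d∈fI)
        D' , D'⊆I , D≈fD' = ⊆ˢ-map⁻ D⊆fI
    in x ∷ D' , x∈I ∷ D'⊆I , d≈fx ∷ D≈fD'

  ⋁-≤-f⋁ : ∀ {D D'} → Pointwise (λ d x → d P.≤ f x) D D' → PN.⋁ D P.≤ f (LN.⋁ D')
  ⋁-≤-f⋁ [] = P.minimum _
  ⋁-≤-f⋁ {D' = x ∷ D'} (d≤fx ∷ D≤fD') =
    P.∨-least (P.trans d≤fx (f-mono (L.x≤x∨y x (LN.⋁ D'))))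
              (P.trans (⋁-≤-f⋁ D≤fD') (f-mono (L.y≤x∨y x (LN.⋁ D'))))

  module _ (ω : LN.LinearOrderOnAtoms) (ω' : PN.LinearOrderOnAtoms) where
    open LN.LinearOrderOnAtoms ω using (_<ω_)
    open PN.LinearOrderOnAtoms ω' using () renaming (_<ω_ to _<ω'_; resp to resp')

    module _ (reflects : ∀ {a c} → LN.IsAtom a → LN.IsAtom c → f a <ω' f c → a <ω c) where

      lower-bound-pullback : ∀ {a p D D'} → LN.IsAtom a → f a P.≈ p →
                             Pointwise (λ d x → d P.≈ f x) D D' → LN.IsAtomSet D' →
                             All (p <ω'_) D → All (a <ω_) D'
      lower-bound-pullback ha fa≈p [] [] [] = []
      lower-bound-pullback ha fa≈p (d≈fx ∷ D≈fD') (hx ∷ D'-atoms) (p<d ∷ p<D) =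
        reflects ha hx (resp' (P.Eq.sym fa≈p) d≈fx p<d) ∷ lower-bound-pullback ha fa≈p D≈fD' D'-atoms p<D

      IsNBB-map : ∀ {I} → LN.IsAtomSet I → LN.IsNBB ω I → PN.IsNBB ω' (map f I)
      IsNBB-map I-atoms I-nbb D D⊆fI (D≢[] , p , hp , p<D , p≤⋁D) =
        let a , ha , fa≈p = f-onto-atoms hp
            D' , D'⊆I , D≈fD' = ⊆ˢ-map⁻ D⊆fI
            D'-atoms = AtomProperties.IsAtomSet-⊆ˢ L D'⊆I I-atoms
            fa≤f⋁D' = P.trans (P.reflexive fa≈p)
                        (P.trans p≤⋁D (⋁-≤-f⋁ (Pointwise.map P.reflexive D≈fD')))
        in I-nbb D' D'⊆I (Pointwise-≢[] D≈fD' D≢[] , a , ha ,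
                          lower-bound-pullback ha fa≈p D≈fD' D'-atoms p<D , f-reflect fa≤f⋁D')

  InI-map : LN.IsFinite → LN.IsAtomic → (∀ {a} → LN.IsAtom a → PN.IsAtom (f a)) →
            ∀ {I} → LN.InI I → PN.InI (map f I)
  InI-map finite atomic f-atom (I-atoms , ω , I-nbb) =
    All.map⁺ (All.map f-atom I-atoms) , transported ,
    IsNBB-map ω transported transported-reflects I-atoms I-nbb
    where
    open AtomEnumeration L
    open TransportOrder (atomList finite atomic)
                        (atomList-complete (LinearOrderOnAtomsProperties._≈?_ L ω) finite atomic) ω

lemma3p5 : {c₁ ℓ₁ ℓ₂ c₂ ℓ₃ ℓ₄ : Level}
    → (L : BoundedLattice c₁ ℓ₁ ℓ₂) (P : BoundedLattice c₂ ℓ₃ ℓ₄)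
    → LatticeNotions.IsFinite L
    → LatticeNotions.IsAtomic L
    → (rankL : BoundedLattice.Carrier L → ℕ) → LatticeNotions.IsRank L rankL
    → LatticeNotions.IsGeometric P
    → (rankP : BoundedLattice.Carrier P → ℕ) → LatticeNotions.IsRank P rankP
    → (f' : BoundedLattice.Carrier L → BoundedLattice.Carrier P)
    → (∀ a → LatticeNotions.IsAtom L a → LatticeNotions.IsAtom P (f' a))
    → (∀ a b → LatticeNotions.IsAtom L a → LatticeNotions.IsAtom L b → BoundedLattice._≈_ L a b → BoundedLattice._≈_ P (f' a) (f' b))
    → (∀ a b → LatticeNotions.IsAtom L a → LatticeNotions.IsAtom L b → BoundedLattice._≈_ P (f' a) (f' b) → BoundedLattice._≈_ L a b)
    → (∀ p → LatticeNotions.IsAtom P p → Σ (BoundedLattice.Carrier L) λ a → LatticeNotions.IsAtom L a × BoundedLattice._≈_ P (f' a) p)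
    → (f : BoundedLattice.Carrier L → BoundedLattice.Carrier P)
    → (∀ x y → BoundedLattice._≤_ L x y → BoundedLattice._≤_ P (f x) (f y))
    → (∀ x y → BoundedLattice._≤_ P (f x) (f y) → BoundedLattice._≤_ L x y)
    → (∀ x → rankP (f x) ≡ rankL x)
    → (∀ a → LatticeNotions.IsAtom L a → BoundedLattice._≈_ P (f a) (f' a))
    → (I : List (BoundedLattice.Carrier L))
    → LatticeNotions.InI L I
    → LatticeNotions.InI P (map f I)
lemma3p5 L P finite atomic _ _ _ _ _ _ f'-atom _ _ f'-onto f f-mono f-reflect _ f≈f' I =
  InI-map finite atomic f-atom
  where
  module P = BoundedLattice P

  f-atom : ∀ {a} → LatticeNotions.IsAtom L a → LatticeNotions.IsAtom P (f a)
  f-atom ha = AtomProperties.IsAtom-resp-≈ P (P.Eq.sym (f≈f' _ ha)) (f'-atom _ ha)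

  f-onto-atoms : ∀ {p} → LatticeNotions.IsAtom P p →
                 ∃ λ a → LatticeNotions.IsAtom L a × f a P.≈ p
  f-onto-atoms hp = let a , ha , f'a≈p = f'-onto _ hp in a , ha , P.Eq.trans (f≈f' a ha) f'a≈p

  open OrderEmbedding L P f (f-mono _ _) (f-reflect _ _) f-onto-atoms
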